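{- Let $\ell>r\ge2$ be integers. The function $f$ defined on integers $k\ge r$ by \[f(k)=\frac{(k-1)(k-2)\cdots(k-r+1)}{k^{\ell-1}}\] is unimodal and attains its maximum at a unique integer $m_{r,\ell}\ge r$.
   Context: A function $h:I\to\mathbb R$ on $I\subseteq\mathbb R$ is unimodal if there is $x_0\in I$ such that $h$ is non-decreasing on $I\cap(-\infty,x_0]$ and non-increasing on $I\cap(x_0,\infty)$. -}

module Defs where

open import Data.Nat using (ℕ; zero; suc; _*_; _∸_; _^_; _≤_; _<_)
open import Data.Integer using (+_)
open import Data.Rational using (ℚ; _/_; 0ℚ)
import Data.Rational as Q
open import Data.Product using (Σ; _×_)
open import Relation.Binary.PropositionalEquality using (_≡_)

fallingProd : ℕ → ℕ → ℕ
fallingProd k zero    = 1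
fallingProd k (suc j) = fallingProd k j * (k ∸ suc j)

-- a / d as a rational; the d = 0 case is a junk value, never used below
-- (f is only evaluated at k ≥ r ≥ 2, so the denominator k^(ℓ-1) is nonzero)
frac : ℕ → ℕ → ℚ
frac a zero    = 0ℚ
frac a (suc d) = (+ a) / suc d

f : ℕ → ℕ → ℕ → ℚ
f r ℓ k = frac (fallingProd k (r ∸ 1)) (k ^ (ℓ ∸ 1))

UnimodalFrom : ℕ → (ℕ → ℚ) → Set
UnimodalFrom r h =
  Σ ℕ λ x₀ → (r ≤ x₀)
    × (∀ a b → r ≤ a → a ≤ b → b ≤ x₀ → h a Q.≤ h b)
    × (∀ a b → x₀ < a → a ≤ b → h b Q.≤ h a)

UniqueMaxFrom : ℕ → (ℕ → ℚ) → Set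
UniqueMaxFrom r h =
  Σ ℕ λ m → (r ≤ m)
    × (∀ k → r ≤ k → h k Q.≤ h m)
    × (∀ k → r ≤ k → h k ≡ h m → k ≡ m)

{-# OPTIONS --safe #-}
-- Writing g k = (k-1)⋯(k-n) / k^p with n = r - 1 and p = ℓ - 1, the ratio of
-- consecutive values is g (k+1) / g k = (k / (k-n)) (k / (k+1))^p, so g falls
-- from k to k + 1 iff n < Σ_{j=1}^{p} (k/(k+1))^j.  The right-hand side
-- increases with k, so once g starts falling it keeps falling; it does start
-- falling because p ≥ n + 1 (Bernoulli's inequality at k = n + 1 + n²); and
-- the ratio is never 1 because k + 1 is coprime to k.  Hence g rises strictly
-- up to the first k where it falls and decreases strictly afterwards.
module Submission where

open import Defs
open import Data.Nat using (ℕ; _≤_; _<_)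
open import Data.Product using (_×_)

open import Data.Integer as ℤ using (+_; +<+)
import Data.Integer.Properties as ℤ
open import Data.Nat
  using (zero; suc; _+_; _*_; _∸_; _^_; z≤n; s≤s; z<s; _≤′_; ≤′-refl; ≤′-step; _<?_; >-nonZero)
open import Data.Nat.Coprimality using (Coprime; coprime-+; 1-coprimeTo; coprime-divisor)
open import Data.Nat.Divisibility using (_∤_; divides; ∣1⇒≡1)
open import Data.Nat.Properties
open import Algebra.Properties.CommutativeSemigroup *-commutativeSemigroup
  using (x∙yz≈y∙xz; xy∙z≈xz∙y)
open import Data.Nat.Tactic.RingSolver using (solve-∀)
open import Data.Product using (_,_; ∃-syntax)
open import Data.Rational as ℚ using (ℚ)
import Data.Rational.Properties as ℚ
open import Data.Rational.Unnormalised as ℚᵘ using (mkℚᵘ)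
import Data.Rational.Unnormalised.Properties as ℚᵘ
open import Data.Sum using (inj₁; inj₂)
open import Function using (_∘_; flip)
open import Function.Bundles using (_⇔_; mk⇔; Equivalence)
open import Relation.Binary using (Rel; Transitive; tri<; tri≈; tri>)
open import Relation.Binary.PropositionalEquality
open import Relation.Nullary using (¬_; yes; no; contradiction)
open import Relation.Nullary.Decidable using (decidable-stable)
open import Relation.Unary using (Pred; Decidable)

frac-< : ∀ {a b c d} → 0 < b → 0 < d → a * d < c * b → frac a b ℚ.< frac c d
frac-< {a} {suc b} {c} {suc d} _ _ ad<cb = ℚ.toℚᵘ-cancel-<
  (ℚᵘ.<-respˡ-≃ (ℚᵘ.≃-sym (ℚ.toℚᵘ-fromℚᵘ (mkℚᵘ (+ a) b)))
  (ℚᵘ.<-respʳ-≃ (ℚᵘ.≃-sym (ℚ.toℚᵘ-fromℚᵘ (mkℚᵘ (+ c) d)))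
  (ℚᵘ.*<* (subst₂ ℤ._<_ (ℤ.pos-* a (suc d)) (ℤ.pos-* c (suc b)) (+<+ ad<cb)))))

^-positive : ∀ {m} n → 0 < m → 0 < m ^ n
^-positive {m} n 0<m = m^n>0 m {{>-nonZero 0<m}} n

<-cancel-common-factors : ∀ {x y u v} c d → 0 < d →
                          x * c ≡ d * u → y * c ≡ d * v → u < v → x < y
<-cancel-common-factors {x} {y} c d 0<d xc≡du yc≡dv u<v =
  *-cancelʳ-< c x y (subst₂ _<_ (sym xc≡du) (sym yc≡dv) (*-monoʳ-< d {{>-nonZero 0<d}} u<v))

+-balance-< : ∀ {x y z w} → x + y ≡ z + w → (x < z ⇔ w < y)
+-balance-< {x} {y} {z} {w} eq = mk⇔
  (λ x<z → +-cancelˡ-< z w y (subst (_< z + y) eq (+-monoˡ-< y x<z)))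
  (λ w<y → +-cancelʳ-< y x z (subst (_< z + y) (sym eq) (+-monoʳ-< z w<y)))

fallingProd-shift : ∀ k n → fallingProd (suc k) n * (k ∸ n) ≡ k * fallingProd k n
fallingProd-shift k zero    = *-comm 1 k
fallingProd-shift k (suc n) = begin
  fallingProd (suc k) n * (k ∸ n) * (k ∸ suc n) ≡⟨ cong (_* (k ∸ suc n)) (fallingProd-shift k n) ⟩
  k * fallingProd k n * (k ∸ suc n)            ≡⟨ *-assoc k _ _ ⟩
  k * fallingProd k (suc n)                    ∎
  where open ≡-Reasoning

fallingProd-positive : ∀ {k n} → n < k → 0 < fallingProd k n
fallingProd-positive {n = zero}  _   = z<s
fallingProd-positive {n = suc n} n<k =
  *-mono-< (fallingProd-positive (<-trans (n<1+n n) n<k)) (m<n⇒0<n∸m n<k)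

1+k∤k^j : ∀ {k} j → 0 < k → suc k ∤ k ^ j
1+k∤k^j zero    0<k 1+k∣1 = m<n⇒n≢0 0<k (suc-injective (∣1⇒≡1 1+k∣1))
1+k∤k^j {k} (suc j) 0<k 1+k∣k^[1+j] =
  1+k∤k^j j 0<k (coprime-divisor 1+k-coprime-k 1+k∣k^[1+j])
  where
  1+k-coprime-k : Coprime (suc k) k
  1+k-coprime-k = subst (λ x → Coprime x k) (+-comm k 1) (coprime-+ (1-coprimeTo k))

k^[1+e]≢j*[1+k]^e : ∀ {k} j e → 0 < k → k * k ^ suc e ≢ j * suc k ^ suc e
k^[1+e]≢j*[1+k]^e {k} j e 0<k eq =
  1+k∤k^j (suc (suc e)) 0<k (divides (j * suc k ^ e) (trans eq (x∙yz≈xz∙y j (suc k) _)))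
  where
  x∙yz≈xz∙y : ∀ x y z → x * (y * z) ≡ x * z * y
  x∙yz≈xz∙y = solve-∀

-- powSum a b e = Σ_{j=1}^{e} a^j b^(e-j) = b^e Σ_{j=1}^{e} (a/b)^j
powSum : ℕ → ℕ → ℕ → ℕ
powSum a b zero    = 0
powSum a b (suc e) = a * (b ^ e + powSum a b e)

powSum-gap : ∀ a e → a * suc a ^ e ≡ a * a ^ e + powSum a (suc a) e
powSum-gap a zero    = sym (+-identityʳ (a * 1))
powSum-gap a (suc e) = begin
  a * (suc a * S)               ≡⟨ spread a S ⟩
  a * S + a * (a * S)           ≡⟨ cong (λ t → a * S + a * t) (powSum-gap a e) ⟩
  a * S + a * (a * A + T)       ≡⟨ regroup a S A T ⟩
  a * (a * A) + a * (S + T)     ∎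
  where
  open ≡-Reasoning
  S = suc a ^ e
  A = a ^ e
  T = powSum a (suc a) e
  spread : ∀ a S → a * (suc a * S) ≡ a * S + a * (a * S)
  spread = solve-∀
  regroup : ∀ a S A T → a * S + a * (a * A + T) ≡ a * (a * A) + a * (S + T)
  regroup = solve-∀

powSum-lower : ∀ {a b} e → a ≤ b → e * a ^ e ≤ powSum a b e
powSum-lower zero          _   = z≤n
powSum-lower {a} {b} (suc e) a≤b = begin
  suc e * (a * a ^ e)          ≡⟨ regroup a (a ^ e) e ⟩
  a * (a ^ e + e * a ^ e)      ≤⟨ *-monoʳ-≤ a (+-mono-≤ (^-monoˡ-≤ e a≤b) (powSum-lower e a≤b)) ⟩
  a * (b ^ e + powSum a b e)   ∎
  where
  open ≤-Reasoning
  regroup : ∀ a A e → suc e * (a * A) ≡ a * (A + e * A)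
  regroup = solve-∀

powSum-mono : ∀ {a b c d} e → a * d ≤ c * b → powSum a b e * d ^ e ≤ powSum c d e * b ^ e
powSum-mono zero _ = ≤-refl
powSum-mono {a} {b} {c} {d} (suc e) ad≤cb = begin
  a * (B + T) * (d * D)          ≡⟨ regroup a B T d D ⟩
  (a * d) * (B * D + T * D)      ≤⟨ *-mono-≤ ad≤cb (+-mono-≤ (≤-reflexive (*-comm B D)) (powSum-mono e ad≤cb)) ⟩
  (c * b) * (D * B + T′ * B)     ≡⟨ regroup c D T′ b B ⟨
  c * (D + T′) * (b * B)         ∎
  where
  open ≤-Reasoning
  B = b ^ e
  D = d ^ e
  T = powSum a b e
  T′ = powSum c d e
  regroup : ∀ a B T d D → a * (B + T) * (d * D) ≡ (a * d) * (B * D + T * D)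
  regroup = solve-∀

powSum-ratio-mono : ∀ {a b c d} x e → 0 < d → a * d ≤ c * b →
                    x * b ^ e < powSum a b e → x * d ^ e < powSum c d e
powSum-ratio-mono {a} {b} {c} {d} x e 0<d ad≤cb lt = *-cancelʳ-< (b ^ e) _ _ (begin-strict
  x * d ^ e * b ^ e     ≡⟨ xy∙z≈xz∙y x (d ^ e) (b ^ e) ⟩
  x * b ^ e * d ^ e     <⟨ *-monoˡ-< (d ^ e) {{>-nonZero (^-positive e 0<d)}} lt ⟩
  powSum a b e * d ^ e  ≤⟨ powSum-mono e ad≤cb ⟩
  powSum c d e * b ^ e  ∎)
  where open ≤-Reasoning

bernoulli : ∀ k e → (k + e) * k ^ e ≤ k * suc k ^ e
bernoulli k e = begin
  (k + e) * k ^ e                   ≡⟨ *-distribʳ-+ (k ^ e) k e ⟩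
  k * k ^ e + e * k ^ e             ≤⟨ +-monoʳ-≤ (k * k ^ e) (powSum-lower e (n≤1+n k)) ⟩
  k * k ^ e + powSum k (suc k) e    ≡⟨ powSum-gap k e ⟨
  k * suc k ^ e                     ∎
  where open ≤-Reasoning

module _ {a ℓ} {A : Set a} {_≺_ : Rel A ℓ} (≺-trans : Transitive _≺_) (h : ℕ → A) where

  stepwise′ : ∀ {i j} → suc i ≤′ j → (∀ {k} → i ≤ k → k < j → h k ≺ h (suc k)) → h i ≺ h j
  stepwise′ ≤′-refl          step = step ≤-refl ≤-refl
  stepwise′ (≤′-step 1+i≤′j) step =
    ≺-trans (stepwise′ 1+i≤′j (λ i≤k k<j → step i≤k (m<n⇒m<1+n k<j)))
            (step (<⇒≤ (≤′⇒≤ 1+i≤′j)) ≤-refl)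

  stepwise : ∀ {i j} → i < j → (∀ {k} → i ≤ k → k < j → h k ≺ h (suc k)) → h i ≺ h j
  stepwise = stepwise′ ∘ ≤⇒≤′

module _ {ℓ} {P : Pred ℕ ℓ} (P? : Decidable P) {lo : ℕ}
         (P-suc : ∀ {k} → lo ≤ k → P k → P (suc k)) where

  P-upward : ∀ {j k} → lo ≤ j → j ≤′ k → P j → P k
  P-upward lo≤j ≤′-refl        Pj = Pj
  P-upward lo≤j (≤′-step j≤′k) Pj = P-suc (≤-trans lo≤j (≤′⇒≤ j≤′k)) (P-upward lo≤j j≤′k Pj)

  threshold : ∀ {x} → lo ≤′ x → P x →
              ∃[ m ] lo ≤ m × (∀ {k} → lo ≤ k → k < m → ¬ P k) × (∀ {k} → m ≤ k → P k)
  threshold ≤′-refl Plo =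
    lo , ≤-refl , (λ lo≤k k<lo _ → <⇒≱ k<lo lo≤k) , (λ lo≤k → P-upward ≤-refl (≤⇒≤′ lo≤k) Plo)
  threshold {suc x} (≤′-step lo≤′x) P[1+x] with P? x
  ... | yes Px  = threshold lo≤′x Px
  ... | no  ¬Px = suc x , lo≤1+x
                , (λ lo≤k k<1+x Pk → ¬Px (P-upward lo≤k (≤⇒≤′ (≤-pred k<1+x)) Pk))
                , (λ 1+x≤k → P-upward lo≤1+x (≤⇒≤′ 1+x≤k) P[1+x])
    where
    lo≤1+x : lo ≤ suc x
    lo≤1+x = ≤′⇒≤ (≤′-step lo≤′x)

module _ (h : ℕ → ℚ) {lo m : ℕ} (lo≤m : lo ≤ m)
         (ascent  : ∀ {k} → lo ≤ k → k < m → h k ℚ.< h (suc k))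
         (descent : ∀ {k} → m ≤ k → h (suc k) ℚ.< h k) where

  rising : ∀ {i j} → lo ≤ i → i < j → j ≤ m → h i ℚ.< h j
  rising lo≤i i<j j≤m =
    stepwise {_≺_ = ℚ._<_} ℚ.<-trans h i<j (λ i≤k k<j → ascent (≤-trans lo≤i i≤k) (<-≤-trans k<j j≤m))

  falling : ∀ {i j} → m ≤ i → i < j → h j ℚ.< h i
  falling m≤i i<j =
    stepwise {_≺_ = flip ℚ._<_} (flip ℚ.<-trans) h i<j (λ i≤k _ → descent (≤-trans m≤i i≤k))

  below-peak : ∀ {k} → lo ≤ k → k ≢ m → h k ℚ.< h m
  below-peak {k} lo≤k k≢m with <-cmp k m
  ... | tri< k<m _ _ = rising lo≤k k<m ≤-refl
  ... | tri≈ _ k≡m _ = contradiction k≡m k≢m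
  ... | tri> _ _ m<k = falling ≤-refl m<k

  peak⇒unimodal : UnimodalFrom lo h
  peak⇒unimodal = m , lo≤m , nondecreasing , nonincreasing
    where
    nondecreasing : ∀ a b → lo ≤ a → a ≤ b → b ≤ m → h a ℚ.≤ h b
    nondecreasing a b lo≤a a≤b b≤m with m≤n⇒m<n∨m≡n a≤b
    ... | inj₁ a<b  = ℚ.<⇒≤ (rising lo≤a a<b b≤m)
    ... | inj₂ refl = ℚ.≤-refl
    nonincreasing : ∀ a b → m < a → a ≤ b → h b ℚ.≤ h a
    nonincreasing a b m<a a≤b with m≤n⇒m<n∨m≡n a≤b
    ... | inj₁ a<b  = ℚ.<⇒≤ (falling (<⇒≤ m<a) a<b)
    ... | inj₂ refl = ℚ.≤-refl

  peak⇒uniqueMax : UniqueMaxFrom lo h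
  peak⇒uniqueMax = m , lo≤m , maximal , unique
    where
    maximal : ∀ k → lo ≤ k → h k ℚ.≤ h m
    maximal k lo≤k with k ≟ m
    ... | yes refl = ℚ.≤-refl
    ... | no  k≢m  = ℚ.<⇒≤ (below-peak lo≤k k≢m)
    unique : ∀ k → lo ≤ k → h k ≡ h m → k ≡ m
    unique k lo≤k hk≡hm =
      decidable-stable (k ≟ m) (λ k≢m → ℚ.<-irrefl hk≡hm (below-peak lo≤k k≢m))

persistent-fall⇒peak : ∀ {ℓ} {P : Pred ℕ ℓ} (h : ℕ → ℚ) → Decidable P → ∀ {lo} →
                       (∀ {k} → lo ≤ k → P k → P (suc k)) →
                       (∀ {k} → lo ≤ k → ¬ P k → h k ℚ.< h (suc k)) →
                       (∀ {k} → lo ≤ k → P k → h (suc k) ℚ.< h k) →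
                       ∀ {x} → lo ≤ x → P x → UnimodalFrom lo h × UniqueMaxFrom lo h
persistent-fall⇒peak h P? {lo} P-suc ascent descent lo≤x Px
  with threshold P? P-suc (≤⇒≤′ lo≤x) Px
... | m , lo≤m , ¬P-below , P-above =
  peak⇒unimodal h lo≤m ascent′ descent′ , peak⇒uniqueMax h lo≤m ascent′ descent′
  where
  ascent′ : ∀ {k} → lo ≤ k → k < m → h k ℚ.< h (suc k)
  ascent′ lo≤k k<m = ascent lo≤k (¬P-below lo≤k k<m)
  descent′ : ∀ {k} → m ≤ k → h (suc k) ℚ.< h k
  descent′ m≤k = descent (≤-trans lo≤m m≤k) (P-above m≤k)

module Profile (n e : ℕ) where

  p : ℕ
  p = suc e

  g : ℕ → ℚ
  g k = frac (fallingProd k n) (k ^ p)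

  Falls : ℕ → Set
  Falls k = k * k ^ p < (k ∸ n) * suc k ^ p

  falls? : Decidable Falls
  falls? k = k * k ^ p <? (k ∸ n) * suc k ^ p

  cross-next : ∀ k → fallingProd (suc k) n * k ^ p * (k ∸ n) ≡ fallingProd k n * (k * k ^ p)
  cross-next k = begin
    fallingProd (suc k) n * k ^ p * (k ∸ n)  ≡⟨ xy∙z≈xz∙y (fallingProd (suc k) n) (k ^ p) (k ∸ n) ⟩
    fallingProd (suc k) n * (k ∸ n) * k ^ p  ≡⟨ cong (_* k ^ p) (fallingProd-shift k n) ⟩
    k * fallingProd k n * k ^ p              ≡⟨ cong (_* k ^ p) (*-comm k _) ⟩
    fallingProd k n * k * k ^ p              ≡⟨ *-assoc (fallingProd k n) k (k ^ p) ⟩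
    fallingProd k n * (k * k ^ p)            ∎
    where open ≡-Reasoning

  cross-this : ∀ k → fallingProd k n * suc k ^ p * (k ∸ n) ≡ fallingProd k n * ((k ∸ n) * suc k ^ p)
  cross-this k = trans (*-assoc (fallingProd k n) _ _) (cong (fallingProd k n *_) (*-comm _ (k ∸ n)))

  descent : ∀ {k} → n < k → Falls k → g (suc k) ℚ.< g k
  descent {k} n<k falls = frac-< (^-positive p z<s) (^-positive p (<-≤-trans z<s n<k))
    (<-cancel-common-factors (k ∸ n) (fallingProd k n) (fallingProd-positive n<k)
      (cross-next k) (cross-this k) falls)

  ascent : ∀ {k} → n < k → ¬ Falls k → g k ℚ.< g (suc k)
  ascent {k} n<k ¬falls = frac-< (^-positive p 0<k) (^-positive p z<s)
    (<-cancel-common-factors (k ∸ n) (fallingProd k n) (fallingProd-positive n<k)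
      (cross-this k) (cross-next k) rises)
    where
    0<k : 0 < k
    0<k = <-≤-trans z<s n<k
    rises : (k ∸ n) * suc k ^ p < k * k ^ p
    rises = ≤∧≢⇒< (≮⇒≥ ¬falls) (k^[1+e]≢j*[1+k]^e (k ∸ n) e 0<k ∘ sym)

  falls⇔powSum : ∀ {k} → n ≤ k → Falls k ⇔ n * suc k ^ p < powSum k (suc k) p
  falls⇔powSum {k} n≤k = +-balance-< (begin
    k * k ^ p + powSum k (suc k) p  ≡⟨ powSum-gap k p ⟨
    k * suc k ^ p                   ≡⟨ cong (_* suc k ^ p) (m∸n+n≡m n≤k) ⟨
    (k ∸ n + n) * suc k ^ p         ≡⟨ *-distribʳ-+ (suc k ^ p) (k ∸ n) n ⟩
    (k ∸ n) * suc k ^ p + n * suc k ^ p ∎)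
    where open ≡-Reasoning

  falls-suc : ∀ {k} → n < k → Falls k → Falls (suc k)
  falls-suc {k} n<k =
    Equivalence.from (falls⇔powSum (m≤n⇒m≤1+n (<⇒≤ n<k)))
    ∘ powSum-ratio-mono {a = k} {c = suc k} n p z<s k[k+2]≤[k+1]²
    ∘ Equivalence.to (falls⇔powSum (<⇒≤ n<k))
    where
    k[k+2]≤[k+1]² : k * suc (suc k) ≤ suc k * suc k
    k[k+2]≤[k+1]² = ≤-trans (n≤1+n _) (≤-reflexive (square k))
      where
      square : ∀ k → suc (k * suc (suc k)) ≡ suc k * suc k
      square = solve-∀

  -- At k = n + 1 + n², Bernoulli reduces the claim to k² < (n² + 1)(k + n + 1),
  -- which holds with slack exactly 1.
  falls-eventually : n < p → Falls (n + suc (n * n))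
  falls-eventually n<p = subst (λ m → k * k ^ p < m * suc k ^ p) (sym (m+n∸m≡n n m)) k^[1+p]<m[1+k]^p
    where
    m = suc (n * n)
    k = n + m
    k²<m[k+p] : k * k < m * (k + p)
    k²<m[k+p] = ≤-trans (≤-reflexive (slack n)) (*-monoʳ-≤ m (+-monoʳ-≤ k n<p))
      where
      slack : ∀ n → suc ((n + suc (n * n)) * (n + suc (n * n)))
                    ≡ suc (n * n) * ((n + suc (n * n)) + suc n)
      slack = solve-∀
    k^[1+p]<m[1+k]^p : k * k ^ p < m * suc k ^ p
    k^[1+p]<m[1+k]^p = *-cancelˡ-< k _ _ (begin-strict
      k * (k * k ^ p)      ≡⟨ *-assoc k k (k ^ p) ⟨
      k * k * k ^ p        <⟨ *-monoˡ-< (k ^ p) {{>-nonZero (^-positive p (<-≤-trans z<s (m≤n+m m n)))}} k²<m[k+p] ⟩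
      m * (k + p) * k ^ p  ≡⟨ *-assoc m (k + p) (k ^ p) ⟩
      m * ((k + p) * k ^ p) ≤⟨ *-monoʳ-≤ m (bernoulli k p) ⟩
      m * (k * suc k ^ p)  ≡⟨ x∙yz≈y∙xz m k (suc k ^ p) ⟩
      k * (m * suc k ^ p)  ∎)
      where open ≤-Reasoning

-- Of 2 ≤ r only r ≠ 0 is used: it keeps k = 0, where f takes a junk value, out of the domain.
lemma3p2 : (r ℓ : ℕ) → 2 ≤ r → r < ℓ →
    UnimodalFrom r (f r ℓ) × UniqueMaxFrom r (f r ℓ)
lemma3p2 (suc n) (suc zero)    _ (s≤s ())
lemma3p2 (suc n) (suc (suc e)) _ (s≤s n<p) =
  persistent-fall⇒peak g falls? falls-suc ascent descent
    (m<m+n n z<s) (falls-eventually n<p)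
  where open Profile n e
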